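{- Let $A\subseteq\mathbb{N}$ be a multiplicative $IP^*$ set and let $n\in\mathbb{N}$. (1) If $n\geq 2$, then $\log_n[A]=\{m\in\mathbb{N}: n^m\in A\}$ is an additive $IP^*$ set. (2) If $n\geq 1$, then $A^{1/n}=\{m\in\mathbb{N}: m^n\in A\}$ is a multiplicative $IP^*$ set.
   Context: For $X\subseteq\mathbb{N}$, $FS(X)=\{\sum_{i=0}^n x_i : n\in\mathbb{N},\ x_i\in X,\ x_0<\dots<x_n\}$ and $FP(X)=\{\prod_{i=0}^n x_i : n\in\mathbb{N},\ x_i\in X,\ x_0<\dots<x_n\}$. A set $C\subseteq\mathbb{N}$ is an additive (resp. multiplicative) $IP$ set if it contains $FS(X)$ (resp. $FP(X)$) for some infinite $X\subseteq\mathbb{N}$. A set is an additive (resp. multiplicative) $IP^*$ set if its complement in $\mathbb{N}$ is not an additive (resp. multiplicative) $IP$ set. -}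

module Defs where

open import Data.Nat using (ℕ; _+_; _*_; _^_; _≤_; _<_)
open import Data.List using (List; []; _∷_)
open import Data.Nat.ListAction using (sum; product)
open import Data.List.Relation.Unary.All using (All)
open import Data.List.Relation.Unary.Linked using (Linked)
open import Data.Product using (Σ; _×_; ∃)
open import Relation.Binary.PropositionalEquality using (_≡_)
open import Relation.Nullary using (¬_)

-- Convention: ℕ in the paper is {1,2,3,...}. A subset of the paper's ℕ is
-- represented by a predicate on Agda's ℕ; only positive elements matter.
Subset : Set₁
Subset = ℕ → Set

Positive : Subset → Set
Positive X = ∀ x → X x → 1 ≤ x

Infinite : Subset → Set
Infinite X = ∀ N → ∃ λ x → N < x × X x

FS : Subset → Subset
FS X k = Σ ℕ λ x → Σ (List ℕ) λ xs →
  Linked _<_ (x ∷ xs) × All X (x ∷ xs) × sum (x ∷ xs) ≡ k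

FP : Subset → Subset
FP X k = Σ ℕ λ x → Σ (List ℕ) λ xs →
  Linked _<_ (x ∷ xs) × All X (x ∷ xs) × product (x ∷ xs) ≡ k

Compl : Subset → Subset
Compl A k = 1 ≤ k × ¬ A k

AdditiveIP : Subset → Set₁
AdditiveIP C = ∃ λ (X : Subset) → Positive X × Infinite X × (∀ k → FS X k → C k)

MultiplicativeIP : Subset → Set₁
MultiplicativeIP C = ∃ λ (X : Subset) → Positive X × Infinite X × (∀ k → FP X k → C k)

AdditiveIP* : Subset → Set₁
AdditiveIP* A = ¬ AdditiveIP (Compl A)

MultiplicativeIP* : Subset → Set₁
MultiplicativeIP* A = ¬ MultiplicativeIP (Compl A)

Log : ℕ → Subset → Subset
Log n A m = 1 ≤ m × A (n ^ m)

Root : ℕ → Subset → Subset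
Root n A m = 1 ≤ m × A (m ^ n)

module Submission where

-- Both parts of the lemma are instances of one transfer principle.
--
-- Let f : ℕ → ℕ be strictly increasing and let it turn one way of
-- aggregating a finite list into another: f (agg₁ xs) ≡ agg₂ (map f xs).
-- If X is infinite with FS/FP-style aggregates FA agg₁ X ⊆ C, then the image
-- f[X] is infinite and every increasing aggregate of f[X] is f applied to an
-- increasing aggregate of X (f reflects <, so increasing lists pull back).
-- Hence an IP set (w.r.t. agg₁) avoiding f⁻¹[A] is mapped to an IP set
-- (w.r.t. agg₂) avoiding A: preimages of IP* sets are IP* sets.
--
-- Part (1) takes f = (n ^_) with n ≥ 2, turning sums into products;
-- part (2) takes f = (_^ n) with n ≥ 1, turning products into products.
-- In both cases the homomorphism property is a list fold of a binary law.

open import Defs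
open import Data.Nat using (ℕ; zero; suc; _≤_; _<_; _*_; _^_; z≤n; >-nonZero)
open import Data.Nat.Properties
open import Data.Nat.ListAction using (sum; product)
open import Data.List using (List; []; _∷_; foldr; map)
open import Data.List.Relation.Unary.All using (All; []; _∷_)
open import Data.List.Relation.Unary.Linked as Linked using (Linked)
open import Data.List.Relation.Unary.Linked.Properties using (map⁻)
open import Data.Product using (_×_; _,_; Σ; ∃)
open import Relation.Binary.PropositionalEquality
open import Relation.Nullary using (¬_; contradiction)
open import Relation.Binary.Definitions using (tri<; tri≈; tri>)
open import Algebra.Properties.CommutativeSemigroup *-commutativeSemigroup using (x∙yz≈y∙xz)

FA : (List ℕ → ℕ) → Subset → Subset
FA agg X k = Σ ℕ λ x → Σ (List ℕ) λ xs →
  Linked _<_ (x ∷ xs) × All X (x ∷ xs) × agg (x ∷ xs) ≡ k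

IP : (List ℕ → ℕ) → Subset → Set₁
IP agg C = ∃ λ (X : Subset) → Positive X × Infinite X × (∀ k → FA agg X k → C k)

IP* : (List ℕ → ℕ) → Subset → Set₁
IP* agg A = ¬ IP agg (Compl A)

Image : (ℕ → ℕ) → Subset → Subset
Image f X y = ∃ λ x → X x × f x ≡ y

Preimage : (ℕ → ℕ) → Subset → Subset
Preimage f A m = 1 ≤ m × A (f m)

StrictlyIncreasing : (ℕ → ℕ) → Set
StrictlyIncreasing f = ∀ {a b} → a < b → f a < f b

Homomorphic : (ℕ → ℕ) → (List ℕ → ℕ) → (List ℕ → ℕ) → Set
Homomorphic f agg₁ agg₂ = ∀ xs → f (agg₁ xs) ≡ agg₂ (map f xs)

module _ {f : ℕ → ℕ} (f-< : StrictlyIncreasing f) where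

  -- A strictly increasing self-map of ℕ never moves a point down; this is
  -- what makes images of positive, unbounded sets positive and unbounded.
  inflationary : ∀ x → x ≤ f x
  inflationary zero    = z≤n
  inflationary (suc x) = ≤-<-trans (inflationary x) (f-< (n<1+n x))

  -- A strictly increasing map reflects the order, so increasing lists of
  -- values f x come from increasing lists of arguments.
  reflects-< : ∀ {a b} → f a < f b → a < b
  reflects-< {a} {b} fa<fb with <-cmp a b
  ... | tri< a<b _ _    = a<b
  ... | tri≈ _ refl _   = contradiction fa<fb (<-irrefl refl)
  ... | tri> _ _ b<a    = contradiction (f-< b<a) (<-asym fa<fb)

  image-positive : ∀ {X} → Positive X → Positive (Image f X)
  image-positive pos y (x , Xx , refl) = ≤-trans (pos x Xx) (inflationary x)

  image-infinite : ∀ {X} → Infinite X → Infinite (Image f X)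
  image-infinite inf N with inf N
  ... | x , N<x , Xx = f x , <-≤-trans N<x (inflationary x) , x , Xx , refl

  pullback : ∀ {X} ys → All (Image f X) ys →
    Σ (List ℕ) λ xs → All X xs × map f xs ≡ ys
  pullback []       []                    = [] , [] , refl
  pullback (y ∷ ys) ((x , Xx , refl) ∷ a) with pullback ys a
  ... | xs , Xxs , refl = x ∷ xs , Xx ∷ Xxs , refl

  image-aggregate : ∀ agg₁ agg₂ {X k} → Homomorphic f agg₁ agg₂ →
    FA agg₂ (Image f X) k → ∃ λ m → FA agg₁ X m × f m ≡ k
  image-aggregate agg₁ agg₂ f-hom (y , ys , inc , a , refl)
    with pullback (y ∷ ys) a
  ... | x ∷ xs , Xxs , refl =
    agg₁ (x ∷ xs) , (x , xs , increasing , Xxs , refl) , f-hom (x ∷ xs)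
    where
    increasing : Linked _<_ (x ∷ xs)
    increasing = Linked.map reflects-< (map⁻ inc)

  preimage-IP* : ∀ agg₁ agg₂ {A} → Homomorphic f agg₁ agg₂ →
    IP* agg₂ A → IP* agg₁ (Preimage f A)
  preimage-IP* agg₁ agg₂ {A} f-hom A-IP* (X , pos , inf , avoids) =
    A-IP* (Image f X , image-positive pos , image-infinite inf , image-avoids)
    where
    image-avoids : ∀ k → FA agg₂ (Image f X) k → Compl A k
    image-avoids k fa with image-aggregate agg₁ agg₂ f-hom fa
    ... | m , m∈FA , refl with avoids m m∈FA
    ... | 1≤m , m∉f⁻¹A = ≤-trans 1≤m (inflationary m) , λ Afm → m∉f⁻¹A (1≤m , Afm)

fold-homomorphism : ∀ (f : ℕ → ℕ) {_⊕_ _⊗_ : ℕ → ℕ → ℕ} {e e′ : ℕ} →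
  f e ≡ e′ → (∀ a b → f (a ⊕ b) ≡ f a ⊗ f b) →
  ∀ xs → f (foldr _⊕_ e xs) ≡ foldr _⊗_ e′ (map f xs)
fold-homomorphism f f-e f-⊕ []       = f-e
fold-homomorphism f {_⊗_ = _⊗_} f-e f-⊕ (x ∷ xs) =
  trans (f-⊕ x _) (cong (f x ⊗_) (fold-homomorphism f f-e f-⊕ xs))

^-distribʳ-* : ∀ a b m → (a * b) ^ m ≡ a ^ m * b ^ m
^-distribʳ-* a b zero    = refl
^-distribʳ-* a b (suc m) = begin
  a * b * (a * b) ^ m       ≡⟨ cong (a * b *_) (^-distribʳ-* a b m) ⟩
  a * b * (a ^ m * b ^ m)   ≡⟨ *-assoc a b _ ⟩
  a * (b * (a ^ m * b ^ m)) ≡⟨ cong (a *_) (x∙yz≈y∙xz b (a ^ m) (b ^ m)) ⟩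
  a * (a ^ m * (b * b ^ m)) ≡⟨ *-assoc a _ _ ⟨
  a * a ^ m * (b * b ^ m)   ∎
  where open ≡-Reasoning

exp-sum : ∀ n → Homomorphic (n ^_) sum product
exp-sum n = fold-homomorphism (n ^_) refl (^-distribˡ-+-* n)

power-product : ∀ n → Homomorphic (_^ n) product product
power-product n = fold-homomorphism (_^ n) (^-zeroˡ n) (λ a b → ^-distribʳ-* a b n)

-- Log n A is the preimage under (n ^_), Root n A the preimage under (_^ n).
lemma2p4 : (A : Subset) → MultiplicativeIP* A → (n : ℕ) →
    (2 ≤ n → AdditiveIP* (Log n A)) × (1 ≤ n → MultiplicativeIP* (Root n A))
lemma2p4 A A-IP* n = logarithm , root
  where
  logarithm : 2 ≤ n → AdditiveIP* (Log n A)
  logarithm 2≤n = preimage-IP* (^-monoʳ-< n 2≤n) sum product (exp-sum n) A-IP*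

  root : 1 ≤ n → MultiplicativeIP* (Root n A)
  root 1≤n = preimage-IP* (^-monoˡ-< n {{>-nonZero 1≤n}}) product product
    (power-product n) A-IP*
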